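{- $\mathbf{K_N^{Horn}} \prec^w \mathbf{K_N^{Bool}}$, i.e. $\mathbf{K_N^{Horn}}$ is weakly less expressive than $\mathbf{K_N^{Bool}}$ over the class of all Kripke frames.
   Context: Fix a finite set $\tau=\{\alpha_1,\dots,\alpha_N\}$ of modality labels and a countable set $\mathcal P$ of propositional letters. Formulas of $\mathbf{K_N}$ (also written $\mathbf{K_N^{Bool}}$) are generated by $\varphi ::= \top \mid p \mid \neg\varphi \mid \varphi\vee\varphi \mid \Diamond_\alpha\varphi \mid \Box_\alpha\varphi$ ($p\in\mathcal P$, $\alpha\in\tau$); $\wedge,\rightarrow$ are abbreviations and $\bot=\neg\top$. A model $M=(W,\{R_\alpha\}_{\alpha\in\tau},V)$ has a nonempty set $W$ of worlds, relations $R_\alpha\subseteq W\times W$, and a valuation $V:W\to 2^{\mathcal P}$; satisfaction $M,w\Vdash\varphi$ is the standard Kripke semantics ($\Diamond_\alpha\psi$ holds at $w$ iff $\psi$ holds at some $R_\alpha$-successor of $w$; $\Box_\alpha\psi$ holds at $w$ iff $\psi$ holds at all $R_\alpha$-successors). Positive literals: $\lambda ::= \top \mid p \mid \Diamond_\alpha\lambda \mid \Box_\alpha\lambda$. A formula is in clausal form if generated by $\varphi ::= \lambda \mid \neg\lambda \mid \nabla(\neg\lambda_1\vee\dots\vee\neg\lambda_n\vee\lambda_{n+1}\vee\dots\vee\lambda_{n+m}) \mid \varphi\wedge\varphi$, where the $\lambda,\lambda_i$ are positive literals and $\nabla$ is a finite (possibly empty) sequence of boxes $\Box_{\alpha_i}\Box_{\alpha_j}\cdots$.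 $\mathbf{K_N^{Horn}}$ consists of clausal-form formulas in which every clause has $m\le 1$. Expressivity (over all Kripke frames): $\mathbf L\preceq^w\mathbf L'$ if, for a fixed alphabet $\mathcal P$, there is an effective translation $\varphi\mapsto\varphi'$ from $\mathbf L$-formulas over $\mathcal P$ to $\mathbf L'$-formulas over the same $\mathcal P$ such that for every model $M$ and world $w$, $M,w\Vdash\varphi$ iff $M,w\Vdash\varphi'$. $\mathbf L\equiv^w\mathbf L'$ means $\mathbf L\preceq^w\mathbf L'$ and $\mathbf L'\preceq^w\mathbf L$; $\mathbf L\prec^w\mathbf L'$ means $\mathbf L\preceq^w\mathbf L'$ and not $\mathbf L\equiv^w\mathbf L'$. -}

module Defs where

open import Level using (Level; suc; _⊔_) renaming (zero to lzero)
open import Data.Nat using (ℕ)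
open import Data.Fin using (Fin)
open import Data.List using (List; []; _∷_; foldr; map; _++_)
open import Data.Maybe using (Maybe; just; nothing)
open import Data.Product using (Σ; _×_)
open import Data.Empty using (⊥)
open import Data.Unit using (⊤)
open import Relation.Nullary using (¬_)
open import Function.Bundles using (_⇔_)

-- Propositional letters: P = ℕ (a fixed countable alphabet).
-- Modality labels: τ = Fin N.

record Model (N : ℕ) : Set₁ where
  field
    W : Set
    R : Fin N → W → W → Set
    V : W → ℕ → Set

data Fm (N : ℕ) : Set where
  top  : Fm N
  var  : ℕ → Fm N
  neg  : Fm N → Fm N
  or   : Fm N → Fm N → Fm N
  dia  : Fin N → Fm N → Fm N
  box  : Fin N → Fm N → Fm N

-- Classical satisfaction, rendered via the (Gödel–Gentzen) double-negation
-- translation, so every satisfaction type is ¬¬-stable and the semantics is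
-- the standard classical Kripke semantics.
sat : {N : ℕ} (M : Model N) → Model.W M → Fm N → Set
sat M w top       = ⊤
sat M w (var p)   = ¬ ¬ Model.V M w p
sat M w (neg φ)   = ¬ sat M w φ
sat M w (or φ ψ)  = ¬ (¬ sat M w φ × ¬ sat M w ψ)
sat M w (dia a φ) = ¬ ((v : Model.W M) → Model.R M a w v → ¬ sat M v φ)
sat M w (box a φ) = (v : Model.W M) → Model.R M a w v → sat M v φ

bot : {N : ℕ} → Fm N
bot = neg top

and : {N : ℕ} → Fm N → Fm N → Fm N
and φ ψ = neg (or (neg φ) (neg ψ))

data Lit (N : ℕ) : Set where
  ltop : Lit N
  lvar : ℕ → Lit N
  ldia : Fin N → Lit N → Lit N
  lbox : Fin N → Lit N → Lit N

litFm : {N : ℕ} → Lit N → Fm N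
litFm ltop       = top
litFm (lvar p)   = var p
litFm (ldia a l) = dia a (litFm l)
litFm (lbox a l) = box a (litFm l)

-- A Horn clause  ∇(¬λ₁ ∨ … ∨ ¬λₙ ∨ λₙ₊₁ ∨ … ∨ λₙ₊ₘ)  with m ≤ 1:
-- 'boxes' is the box prefix ∇, 'negs' = [λ₁,…,λₙ], 'pos' = the optional λₙ₊₁.
record HornClause (N : ℕ) : Set where
  constructor clause
  field
    boxes : List (Fin N)
    negs  : List (Lit N)
    pos   : Maybe (Lit N)

data Horn (N : ℕ) : Set where
  hlit    : Lit N → Horn N
  hneglit : Lit N → Horn N
  hclause : HornClause N → Horn N
  hand    : Horn N → Horn N → Horn N

disj : {N : ℕ} → List (Fm N) → Fm N
disj []           = bot
disj (φ ∷ [])     = φ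
disj (φ ∷ ψ ∷ φs) = or φ (disj (ψ ∷ φs))

maybeList : {A : Set} → Maybe A → List A
maybeList nothing  = []
maybeList (just x) = x ∷ []

hornFm : {N : ℕ} → Horn N → Fm N
hornFm (hlit l)    = litFm l
hornFm (hneglit l) = neg (litFm l)
hornFm (hclause (clause bs ns p)) =
  foldr box (disj (map (λ l → neg (litFm l)) ns ++ map litFm (maybeList p))) bs
hornFm (hand φ ψ)  = and (hornFm φ) (hornFm ψ)

record Language (N : ℕ) : Set₁ where
  field
    Form : Set
    Sat  : (M : Model N) → Model.W M → Form → Set

KBool : (N : ℕ) → Language N
KBool N = record { Form = Fm N ; Sat = sat }

KHorn : (N : ℕ) → Language N
KHorn N = record { Form = Horn N ; Sat = λ M w φ → sat M w (hornFm φ) }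

-- L ≼ʷ L' : a (computable, as every Agda function) translation preserving
-- truth at every world of every model.
_≼ʷ_ : {N : ℕ} → Language N → Language N → Set₁
L ≼ʷ L' = Σ (Language.Form L → Language.Form L') λ t →
  (M : Model _) (w : Model.W M) (φ : Language.Form L) →
  Language.Sat L M w φ ⇔ Language.Sat L' M w (t φ)

_≡ʷ_ : {N : ℕ} → Language N → Language N → Set₁
L ≡ʷ L' = (L ≼ʷ L') × (L' ≼ʷ L)

_≺ʷ_ : {N : ℕ} → Language N → Language N → Set₁
L ≺ʷ L' = (L ≼ʷ L') × ¬ (L ≡ʷ L')

-- Every Horn formula holding at the single dead-end world under two valuations
-- also holds under their intersection: positive literals evaluate there to
-- constants or letters, hence commute with intersection, and a Horn clause is
-- an implication from a conjunction of such literals to at most one of them.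
-- The Boolean formula p₀ ∨ p₁ holds under {p₀} and under {p₁} but not under
-- their empty intersection, so it has no Horn equivalent.
module Submission where

open import Defs
open import Data.Nat using (ℕ; _≡ᵇ_)
open import Data.Bool using (Bool; true; false; not; _∧_; _∨_; T)
open import Data.Bool.Properties using (T-∧; not-involutive; ∨-identityʳ)
open import Data.Unit using (⊤; tt)
open import Data.Empty using (⊥)
open import Data.List using (List; []; _∷_; map; _++_)
open import Data.Bool.ListAction using (any)
open import Data.Maybe using (Maybe; just; nothing)
open import Data.Product using (_×_; _,_)
open import Relation.Nullary using (¬_)
open import Relation.Binary.PropositionalEquality using (_≡_; refl; sym; cong; subst)
open import Function using (_∘_)
open import Function.Bundles using (_⇔_; mk⇔; Equivalence)
import Function.Properties.Equivalence as ⇔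

Valuation : Set
Valuation = ℕ → Bool

_∩_ : Valuation → Valuation → Valuation
(f ∩ g) p = f p ∧ g p

∩-Closed : (Valuation → Bool) → Set
∩-Closed P = ∀ f g → T (P f) → T (P g) → T (P (f ∩ g))

∩-Multiplicative : (Valuation → Bool) → Set
∩-Multiplicative P = ∀ f g → P (f ∩ g) ≡ P f ∧ P g

private variable P Q : Valuation → Bool

∩-closed-resp : (∀ f → P f ≡ Q f) → ∩-Closed P → ∩-Closed Q
∩-closed-resp P≗Q closed f g Pf Pg =
  subst T (P≗Q (f ∩ g)) (closed f g (subst T (sym (P≗Q f)) Pf) (subst T (sym (P≗Q g)) Pg))

∩-closed-true : ∩-Closed (λ _ → true)
∩-closed-true _ _ _ _ = tt

∩-closed-false : ∩-Closed (λ _ → false)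
∩-closed-false _ _ ()

∩-closed-∧ : ∩-Closed P → ∩-Closed Q → ∩-Closed (λ f → P f ∧ Q f)
∩-closed-∧ P-closed Q-closed f g PQf PQg
  with Equivalence.to T-∧ PQf | Equivalence.to T-∧ PQg
... | Pf , Qf | Pg , Qg = Equivalence.from T-∧ (P-closed f g Pf Pg , Q-closed f g Qf Qg)

∩-multiplicative⇒closed : ∩-Multiplicative P → ∩-Closed P
∩-multiplicative⇒closed mult f g Pf Pg =
  subst T (sym (mult f g)) (Equivalence.from T-∧ (Pf , Pg))

∩-multiplicative⇒not-closed : ∩-Multiplicative P → ∩-Closed (not ∘ P)
∩-multiplicative⇒not-closed {P} mult f g ¬Pf _ rewrite mult f g with P f
... | false = tt

∩-closed-→ : ∩-Multiplicative P → ∩-Closed Q → ∩-Closed (λ f → not (P f) ∨ Q f)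
∩-closed-→ {P} mult Q-closed f g P→Qf P→Qg rewrite mult f g with P f | P g
... | false | _    = tt
... | true  | false = tt
... | true  | true  = Q-closed f g P→Qf P→Qg

module _ {N : ℕ} where

  pointModel : Valuation → Model N
  pointModel f = record { W = ⊤ ; R = λ _ _ _ → ⊥ ; V = λ _ p → T (f p) }

  eval : Valuation → Fm N → Bool
  eval f top       = true
  eval f (var p)   = f p
  eval f (neg φ)   = not (eval f φ)
  eval f (or φ ψ)  = eval f φ ∨ eval f ψ
  eval f (dia a φ) = false
  eval f (box a φ) = true

  private
    ¬¬T⇔T : ∀ b → (¬ ¬ T b) ⇔ T b
    ¬¬T⇔T true  = mk⇔ (λ _ → tt) (λ t ¬t → ¬t t)
    ¬¬T⇔T false = mk⇔ (λ ¬¬t → ¬¬t (λ ())) (λ ())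

    ⇔T-not : ∀ {A : Set} b → A ⇔ T b → (¬ A) ⇔ T (not b)
    ⇔T-not true  A⇔ = mk⇔ (λ ¬a → ¬a (Equivalence.from A⇔ tt)) (λ ())
    ⇔T-not false A⇔ = mk⇔ (λ _ → tt) (λ _ → Equivalence.to A⇔)

    ⇔T-∨ : ∀ {A B : Set} a b → A ⇔ T a → B ⇔ T b → (¬ (¬ A × ¬ B)) ⇔ T (a ∨ b)
    ⇔T-∨ true  _     A⇔ _  = mk⇔ (λ _ → tt) (λ _ (¬a , _) → ¬a (Equivalence.from A⇔ tt))
    ⇔T-∨ false true  _  B⇔ = mk⇔ (λ _ → tt) (λ _ (_ , ¬b) → ¬b (Equivalence.from B⇔ tt))
    ⇔T-∨ false false A⇔ B⇔ =
      mk⇔ (λ ¬¬a∨b → ¬¬a∨b (Equivalence.to A⇔ , Equivalence.to B⇔)) (λ ())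

  sat-pointModel : ∀ f φ → sat (pointModel f) tt φ ⇔ T (eval f φ)
  sat-pointModel f top       = ⇔.refl
  sat-pointModel f (var p)   = ¬¬T⇔T (f p)
  sat-pointModel f (neg φ)   = ⇔T-not (eval f φ) (sat-pointModel f φ)
  sat-pointModel f (or φ ψ)  =
    ⇔T-∨ (eval f φ) (eval f ψ) (sat-pointModel f φ) (sat-pointModel f ψ)
  sat-pointModel f (dia a φ) = mk⇔ (λ ¬□¬ → ¬□¬ (λ _ ())) (λ ())
  sat-pointModel f (box a φ) = mk⇔ (λ _ → tt) (λ _ _ ())

  eval-lit-∩-multiplicative : ∀ l → ∩-Multiplicative (λ f → eval f (litFm l))
  eval-lit-∩-multiplicative ltop       f g = refl
  eval-lit-∩-multiplicative (lvar p)   f g = refl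
  eval-lit-∩-multiplicative (ldia a l) f g = refl
  eval-lit-∩-multiplicative (lbox a l) f g = refl

  eval-disj : ∀ f φs → eval f (disj φs) ≡ any (eval f) φs
  eval-disj f []           = refl
  eval-disj f (φ ∷ [])     = sym (∨-identityʳ (eval f φ))
  eval-disj f (φ ∷ ψ ∷ φs) = cong (eval f φ ∨_) (eval-disj f (ψ ∷ φs))

  eval-and : ∀ f φ ψ → eval f (and φ ψ) ≡ eval f φ ∧ eval f ψ
  eval-and f φ ψ with eval f φ
  ... | true  = not-involutive (eval f ψ)
  ... | false = refl

  clauseDisjuncts : List (Lit N) → Maybe (Lit N) → List (Fm N)
  clauseDisjuncts ns p = map (λ l → neg (litFm l)) ns ++ map litFm (maybeList p)

  horn-clause-body-∩-closed : ∀ ns p → ∩-Closed (λ f → any (eval f) (clauseDisjuncts ns p))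
  horn-clause-body-∩-closed []       nothing  = ∩-closed-false
  horn-clause-body-∩-closed []       (just l) =
    ∩-closed-resp (λ f → sym (∨-identityʳ (eval f (litFm l))))
      (∩-multiplicative⇒closed (eval-lit-∩-multiplicative l))
  horn-clause-body-∩-closed (l ∷ ns) p =
    ∩-closed-→ (eval-lit-∩-multiplicative l) (horn-clause-body-∩-closed ns p)

  hornFm-∩-closed : ∀ h → ∩-Closed (λ f → eval f (hornFm h))
  hornFm-∩-closed (hlit l)    = ∩-multiplicative⇒closed (eval-lit-∩-multiplicative l)
  hornFm-∩-closed (hneglit l) = ∩-multiplicative⇒not-closed (eval-lit-∩-multiplicative l)
  hornFm-∩-closed (hclause (clause (_ ∷ _) ns p)) = ∩-closed-true
  hornFm-∩-closed (hclause (clause [] ns p)) =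
    ∩-closed-resp (λ f → sym (eval-disj f (clauseDisjuncts ns p))) (horn-clause-body-∩-closed ns p)
  hornFm-∩-closed (hand φ ψ) =
    ∩-closed-resp (λ f → sym (eval-and f (hornFm φ) (hornFm ψ)))
      (∩-closed-∧ (hornFm-∩-closed φ) (hornFm-∩-closed ψ))

  Horn-equivalent⇒∩-closed : ∀ φ h → (∀ M w → sat M w φ ⇔ sat M w (hornFm h)) →
                             ∩-Closed (λ f → eval f φ)
  Horn-equivalent⇒∩-closed φ h φ⇔h f g φf φg =
    Equivalence.from (atPoint (f ∩ g))
      (hornFm-∩-closed h f g (Equivalence.to (atPoint f) φf) (Equivalence.to (atPoint g) φg))
    where
    atPoint : ∀ f → T (eval f φ) ⇔ T (eval f (hornFm h))
    atPoint f = ⇔.trans (⇔.sym (sat-pointModel f φ))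
                  (⇔.trans (φ⇔h (pointModel f) tt) (sat-pointModel f (hornFm h)))

  p₀∨p₁ : Fm N
  p₀∨p₁ = or (var 0) (var 1)

  p₀∨p₁-not-∩-closed : ¬ ∩-Closed (λ f → eval f p₀∨p₁)
  p₀∨p₁-not-∩-closed closed = closed (_≡ᵇ 0) (_≡ᵇ 1) tt tt

theorem1 : (N : ℕ) → KHorn N ≺ʷ KBool N
theorem1 N = (hornFm , λ _ _ _ → ⇔.refl) , Horn≢ʷBool
  where
  Horn≢ʷBool : ¬ (KHorn N ≡ʷ KBool N)
  Horn≢ʷBool (_ , (t , t-sound)) =
    p₀∨p₁-not-∩-closed {N} (Horn-equivalent⇒∩-closed p₀∨p₁ (t p₀∨p₁) (λ M w → t-sound M w p₀∨p₁))
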